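{- Let $d\ge 2$ be an integer. A finite simple graph $G$ is $2^{d}$-colorable if and only if $G$ is locatable in $\mathbb{Z}^{d}$.
   Context: For $x,y\in\mathbb{Z}^d$, $\overline{xy}$ is the closed segment joining them; it is primitive if $\overline{xy}\cap\mathbb{Z}^d=\{x,y\}$. A grid drawing of $G=(V,E)$ in $\mathbb{Z}^d$ is an injective map $\phi\colon V\to\mathbb{Z}^d$ such that for every edge $uv\in E$ and vertex $w\in V$, $\phi(w)\in\overline{\phi(u)\phi(v)}$ implies $w\in\{u,v\}$. $G$ is locatable in $\mathbb{Z}^d$ if it has a grid drawing in $\mathbb{Z}^d$ in which every edge $uv$ is represented by a primitive segment $\overline{\phi(u)\phi(v)}$. -}

module Defs where

open import Data.Nat using (ℕ; _^_; _≤_)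
open import Data.Integer as ℤ using (ℤ; +_; _-_; _*_)
open import Data.Fin using (Fin)
open import Data.Vec using (Vec; lookup)
open import Data.Bool using (Bool; true; false)
open import Data.Product using (Σ; _×_; ∃)
open import Data.Sum using (_⊎_)
open import Relation.Binary.PropositionalEquality using (_≡_; _≢_)
open import Relation.Nullary using (¬_)

Point : ℕ → Set
Point d = Vec ℤ d

-- z ∈ closed segment [x,y] in ℝ^d: z = x + t (y - x) for some t ∈ [0,1].
-- Since x,y,z have integer coordinates any such t is rational, t = a / b
-- with a b ∈ ℕ, 0 < b, a ≤ b.
_∈Seg[_,_] : ∀ {d} → Point d → Point d → Point d → Set
_∈Seg[_,_] {d} z x y =
  Σ ℕ λ a → Σ ℕ λ b → (1 ≤ b) × (a ≤ b) ×
    ((i : Fin d) → (+ b) * (lookup z i - lookup x i) ≡ (+ a) * (lookup y i - lookup x i))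

Primitive : ∀ {d} → Point d → Point d → Set
Primitive {d} x y = (z : Point d) → z ∈Seg[ x , y ] → (z ≡ x) ⊎ (z ≡ y)

record SimpleGraph (n : ℕ) : Set where
  field
    adj     : Fin n → Fin n → Bool
    sym     : ∀ u v → adj u v ≡ adj v u
    irrefl  : ∀ u → adj u u ≡ false

open SimpleGraph public

Edge : ∀ {n} → SimpleGraph n → Fin n → Fin n → Set
Edge G u v = adj G u v ≡ true

Colorable : ∀ {n} → ℕ → SimpleGraph n → Set
Colorable {n} k G = Σ (Fin n → Fin k) λ c → ∀ u v → Edge G u v → c u ≢ c v

IsGridDrawing : ∀ {n} (d : ℕ) → SimpleGraph n → (Fin n → Point d) → Set
IsGridDrawing {n} d G φ =
  (∀ u v → φ u ≡ φ v → u ≡ v) ×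
  (∀ u v w → Edge G u v → φ w ∈Seg[ φ u , φ v ] → (w ≡ u) ⊎ (w ≡ v))

Locatable : ∀ {n} (d : ℕ) → SimpleGraph n → Set
Locatable {n} d G = Σ (Fin n → Point d) λ φ →
  IsGridDrawing d G φ × (∀ u v → Edge G u v → Primitive (φ u) (φ v))

-- If the coordinates of two lattice points agree mod 2, the midpoint of the
-- segment joining them is a lattice point, so a primitive segment joins points
-- of different parity classes; the 2^d parity classes therefore properly color
-- every graph located in ℤ^d.
--
-- Conversely, put vertex k ∈ {1, …, n} of color (a, b, r) ∈ {0,1}^d at
-- (a + C k, b + C k², r) with C = (2n+2)!. A segment is primitive as soon as the
-- differences of its endpoints generate the unit ideal of ℤ. For two vertices of
-- different colors that ideal contains the difference of every color bit in
-- which they differ, and such a difference is ±1. For the bits r this is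
-- immediate; for a and b it holds because the secant slope of the parabola is
-- k + l, so Δy − (k + l) Δx = β − α (k + l) does not involve C, is nonzero and has
-- size at most 2n + 1, hence divides C.

module Submission where

open import Data.Fin as Fin using (Fin; zero; suc; toℕ; fromℕ<)
open import Data.Fin.Patterns using (0F; 1F)
open import Data.Fin.Properties using (*↔×; ¬∀⟶∃¬; toℕ<n; toℕ-injective; fromℕ<-injective)
open import Data.Integer using (ℤ; +_; _+_; _-_; _*_; -_; ∣_∣; 0ℤ; 1ℤ; _%ℕ_; _/ℕ_)
open import Data.Integer.DivMod using (a≡a%ℕn+[a/ℕn]*n; n%ℕd<d)
open import Data.Integer.Divisibility.Signed using (_∣_; divides; ∣ᵤ⇒∣)
import Data.Integer.Properties as ℤP
open import Data.Integer.Tactic.RingSolver using (solve-∀)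
open import Data.Nat as ℕ using (ℕ; zero; suc; _^_; _!; _≤_; _<_; s≤s; z≤n)
import Data.Nat.Divisibility as ℕ
open import Data.Nat.DivMod using (_%_; [m+kn]%n≡m%n; m<n⇒m%n≡m)
import Data.Nat.Properties as ℕP
open import Data.Product using (Σ; _×_; _,_; uncurry)
open import Data.Product.Function.NonDependent.Propositional using (_×-↔_)
import Data.Sum as Sum
open import Data.Vec using (Vec; []; _∷_; lookup; map; tabulate)
open import Data.Vec.Properties using (lookup-map; lookup∘tabulate)
open import Data.Vec.Relation.Binary.Pointwise.Extensional using (ext; Pointwise-≡⇒≡)
open import Function using (_∘_)
open import Function.Bundles using (_↔_; _⇔_; mk⇔; mk↔ₛ′; Inverse; Injection)
open import Function.Properties.Inverse using (↔-refl; ↔-sym; ↔-trans; ↔⇒↣)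
open import Relation.Binary.PropositionalEquality
open import Relation.Nullary using (¬_; yes; no; contradiction)

open import Defs hiding (sym)

private
  variable
    d n : ℕ

lookup-ext : ∀ {a} {A : Set a} {xs ys : Vec A d} →
  (∀ i → lookup xs i ≡ lookup ys i) → xs ≡ ys
lookup-ext = Pointwise-≡⇒≡ ∘ ext

×↔∷ : ∀ {a} {A : Set a} → (A × Vec A d) ↔ Vec A (suc d)
×↔∷ = mk↔ₛ′ (uncurry _∷_) (λ { (x ∷ xs) → x , xs }) (λ { (x ∷ xs) → refl }) (λ _ → refl)

2^↔Vec : ∀ d → Fin (2 ^ d) ↔ Vec (Fin 2) d
2^↔Vec zero    = mk↔ₛ′ (λ _ → []) (λ _ → zero) (λ { [] → refl }) (λ { zero → refl })
2^↔Vec (suc d) = ↔-trans *↔× (↔-trans (↔-refl ×-↔ 2^↔Vec d) ×↔∷)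

toBits : ∀ d → Fin (2 ^ d) → Vec (Fin 2) d
toBits d = Inverse.to (2^↔Vec d)

toBits-injective : ∀ d {c c' : Fin (2 ^ d)} → toBits d c ≡ toBits d c' → c ≡ c'
toBits-injective d = Injection.injective (↔⇒↣ (2^↔Vec d))

fromBits : ∀ d → Vec (Fin 2) d → Fin (2 ^ d)
fromBits d = Inverse.from (2^↔Vec d)

fromBits-injective : ∀ d {B B' : Vec (Fin 2) d} → fromBits d B ≡ fromBits d B' → B ≡ B'
fromBits-injective d = Injection.injective (↔⇒↣ (↔-sym (2^↔Vec d)))

Δ : Point d → Point d → Fin d → ℤ
Δ x y i = lookup y i - lookup x i

data ⟨_⟩ (w : Fin d → ℤ) : ℤ → Set where
  gen : ∀ i → ⟨ w ⟩ (w i)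
  _⊕_ : ∀ {c c'} → ⟨ w ⟩ c → ⟨ w ⟩ c' → ⟨ w ⟩ (c + c')
  _⊛_ : ∀ s {c} → ⟨ w ⟩ c → ⟨ w ⟩ (s * c)

i-k≡j-k⇒i≡j : ∀ {i j k : ℤ} → i - k ≡ j - k → i ≡ j
i-k≡j-k⇒i≡j {i} {j} {k} eq = begin
  i           ≡⟨ i≡i-k+k i k ⟩
  (i - k) + k ≡⟨ cong (_+ k) eq ⟩
  (j - k) + k ≡⟨ i≡i-k+k j k ⟨
  j           ∎
  where
  open ≡-Reasoning
  i≡i-k+k : ∀ i k → i ≡ (i - k) + k
  i≡i-k+k = solve-∀

module _ {x y z : Point d} {a b : ℕ} (seg : ∀ i → + b * Δ x z i ≡ + a * Δ x y i) where

  ∈Seg-scaled : ∀ {c} → ⟨ Δ x y ⟩ c → Σ ℤ λ c' → + b * c' ≡ + a * c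
  ∈Seg-scaled (gen i) = Δ x z i , seg i
  ∈Seg-scaled (p ⊕ q) with ∈Seg-scaled p | ∈Seg-scaled q
  ... | c₁ , e₁ | c₂ , e₂ = c₁ + c₂ , (begin
    + b * (c₁ + c₂)         ≡⟨ ℤP.*-distribˡ-+ (+ b) c₁ c₂ ⟩
    + b * c₁ + + b * c₂     ≡⟨ cong₂ _+_ e₁ e₂ ⟩
    + a * _ + + a * _       ≡⟨ ℤP.*-distribˡ-+ (+ a) _ _ ⟨
    + a * _                 ∎)
    where open ≡-Reasoning
  ∈Seg-scaled (s ⊛ p) with ∈Seg-scaled p
  ... | c₁ , e₁ = s * c₁ , (begin
    + b * (s * c₁)   ≡⟨ swap (+ b) s c₁ ⟩
    s * (+ b * c₁)   ≡⟨ cong (s *_) e₁ ⟩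
    s * (+ a * _)    ≡⟨ swap s (+ a) _ ⟩
    + a * (s * _)    ∎)
    where
    open ≡-Reasoning
    swap : ∀ p q r → p * (q * r) ≡ q * (p * r)
    swap = solve-∀

∈Seg-cancel : ∀ {x y z : Point d} b .{{_ : ℕ.NonZero b}} →
  (∀ i → + b * Δ x z i ≡ + b * Δ x y i) → z ≡ y
∈Seg-cancel b seg = lookup-ext λ i → i-k≡j-k⇒i≡j (ℤP.*-cancelˡ-≡ (+ b) _ _ (seg i))

a≤m∧a≡m*q⇒a≡0⊎a≡m : ∀ {a m q} → a ≤ m → a ≡ m ℕ.* q → a ≡ 0 Sum.⊎ a ≡ m
a≤m∧a≡m*q⇒a≡0⊎a≡m {m = m} {zero}  _   a≡m*0 = Sum.inj₁ (trans a≡m*0 (ℕP.*-zeroʳ m))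
a≤m∧a≡m*q⇒a≡0⊎a≡m {m = m} {suc q} a≤m a≡m*q =
  Sum.inj₂ (ℕP.≤-antisym a≤m (subst (m ≤_) (sym a≡m*q) (ℕP.m≤m*n m (suc q))))

unit⇒Primitive : ∀ {x y : Point d} → ⟨ Δ x y ⟩ 1ℤ → Primitive x y
unit⇒Primitive {x = x} {y} unit z (a , suc b , _ , a≤b , seg)
  with ∈Seg-scaled {x = x} {y} {z} {a} {suc b} seg unit
... | c , e with a≤m∧a≡m*q⇒a≡0⊎a≡m a≤b a≡[1+b]*∣c∣
  where
  a≡[1+b]*∣c∣ : a ≡ suc b ℕ.* ∣ c ∣
  a≡[1+b]*∣c∣ = trans (cong ∣_∣ (trans (sym (ℤP.*-identityʳ (+ a))) (sym e))) (ℤP.abs-* (+ suc b) c)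
... | Sum.inj₁ refl = Sum.inj₁ (∈Seg-cancel {x = x} {x} {z} (suc b) λ i → begin
  + suc b * Δ x z i             ≡⟨ seg i ⟩
  0ℤ                            ≡⟨ ℤP.*-zeroʳ (+ suc b) ⟨
  + suc b * 0ℤ                  ≡⟨ cong (+ suc b *_) (ℤP.+-inverseʳ (lookup x i)) ⟨
  + suc b * Δ x x i             ∎)
  where open ≡-Reasoning
... | Sum.inj₂ refl = Sum.inj₂ (∈Seg-cancel {x = x} {y} {z} (suc b) seg)

parity : ℤ → Fin 2
parity x = fromℕ< (n%ℕd<d x 2)

midpoint : Point d → Point d → Point d
midpoint x y = tabulate λ i → lookup x i + (lookup y i /ℕ 2 - lookup x i /ℕ 2)

midpoint-halves : ∀ x y → x %ℕ 2 ≡ y %ℕ 2 →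
  + 2 * ((x + (y /ℕ 2 - x /ℕ 2)) - x) ≡ + 1 * (y - x)
midpoint-halves x y x%2≡y%2 = begin
  + 2 * ((x + (qy - qx)) - x)                  ≡⟨ identity x r qx qy ⟩
  + 1 * ((r + qy * + 2) - (r + qx * + 2))       ≡⟨ cong₂ (λ y' x' → + 1 * (y' - x')) y≡ x≡ ⟨
  + 1 * (y - x)                                 ∎
  where
  open ≡-Reasoning
  qx = x /ℕ 2
  qy = y /ℕ 2
  r = + (x %ℕ 2)
  x≡ : x ≡ r + qx * + 2
  x≡ = a≡a%ℕn+[a/ℕn]*n x 2
  y≡ : y ≡ r + qy * + 2
  y≡ = trans (a≡a%ℕn+[a/ℕn]*n y 2) (cong (λ s → + s + qy * + 2) (sym x%2≡y%2))
  identity : ∀ x r qx qy →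
    + 2 * ((x + (qy - qx)) - x) ≡ + 1 * ((r + qy * + 2) - (r + qx * + 2))
  identity = solve-∀

halving-at-endpoint⇒≡ : ∀ {x y m : ℤ} →
  + 2 * (m - x) ≡ + 1 * (y - x) → m ≡ x Sum.⊎ m ≡ y → x ≡ y
halving-at-endpoint⇒≡ {x} {y} eq (Sum.inj₁ refl) = sym (ℤP.i-j≡0⇒i≡j y x (begin
  y - x                ≡⟨ one* (y - x) ⟩
  + 1 * (y - x)        ≡⟨ eq ⟨
  + 2 * (x - x)        ≡⟨ cong (+ 2 *_) (ℤP.+-inverseʳ x) ⟩
  0ℤ                   ∎))
  where
  open ≡-Reasoning
  one* : ∀ w → w ≡ + 1 * w
  one* = solve-∀
halving-at-endpoint⇒≡ {x} {y} eq (Sum.inj₂ refl) = sym (ℤP.i-j≡0⇒i≡j y x (begin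
  y - x                              ≡⟨ twice-once (y - x) ⟩
  + 2 * (y - x) - + 1 * (y - x)      ≡⟨ cong (_- + 1 * (y - x)) eq ⟩
  + 1 * (y - x) - + 1 * (y - x)      ≡⟨ ℤP.+-inverseʳ (+ 1 * (y - x)) ⟩
  0ℤ                                 ∎))
  where
  open ≡-Reasoning
  twice-once : ∀ w → w ≡ + 2 * w - + 1 * w
  twice-once = solve-∀

same-parity-Primitive⇒≡ : ∀ {x y : Point d} → Primitive x y →
  (∀ i → parity (lookup x i) ≡ parity (lookup y i)) → x ≡ y
same-parity-Primitive⇒≡ {x = x} {y} prim same =
  lookup-ext λ i → halving-at-endpoint⇒≡ (halves i) (Sum.map (cong (at i)) (cong (at i)) endpoint)
  where
  halves : ∀ i → + 2 * Δ x (midpoint x y) i ≡ + 1 * Δ x y i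
  halves i = trans (cong (λ m → + 2 * (m - lookup x i)) (lookup∘tabulate _ i))
                   (midpoint-halves (lookup x i) (lookup y i) (fromℕ<-injective _ _ _ _ (same i)))
  endpoint = prim (midpoint x y) (1 , 2 , s≤s z≤n , s≤s z≤n , halves)
  at : Fin _ → Point _ → ℤ
  at i v = lookup v i

m∣n! : ∀ {m n} → 1 ≤ m → m ≤ n → m ℕ.∣ n !
m∣n! {suc m} _ m≤n = ℕ.∣-trans (ℕ.m∣m*n (m !)) (ℕ.m≤n⇒m!∣n! m≤n)

nonzero∣! : ∀ {N : ℤ} {K} → N ≢ 0ℤ → ∣ N ∣ ≤ K → N ∣ + (K !)
nonzero∣! N≢0 ∣N∣≤K = ∣ᵤ⇒∣ (m∣n! (ℕP.n≢0⇒n>0 (N≢0 ∘ ℤP.∣i∣≡0⇒i≡0)) ∣N∣≤K)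

radix-injective : ∀ {F a a' k l} .{{_ : ℕ.NonZero F}} → a < F → a' < F →
  a ℕ.+ k ℕ.* F ≡ a' ℕ.+ l ℕ.* F → k ≡ l
radix-injective {F} {a} {a'} {k} {l} a<F a'<F eq =
  ℕP.*-cancelʳ-≡ k l F (ℕP.+-cancelˡ-≡ a _ _ (trans eq (cong (ℕ._+ l ℕ.* F) (sym a≡a'))))
  where
  open ≡-Reasoning
  a≡a' : a ≡ a'
  a≡a' = begin
    a                       ≡⟨ m<n⇒m%n≡m a<F ⟨
    a % F                   ≡⟨ [m+kn]%n≡m%n a k F ⟨
    (a ℕ.+ k ℕ.* F) % F     ≡⟨ cong (_% F) eq ⟩
    (a' ℕ.+ l ℕ.* F) % F    ≡⟨ [m+kn]%n≡m%n a' l F ⟩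
    a' % F                  ≡⟨ m<n⇒m%n≡m a'<F ⟩
    a'                      ∎

module Secant {w : Fin d → ℤ} {α β k l C : ℤ}
              (Δx∈ : ⟨ w ⟩ (α + (l - k) * C))
              (Δy∈ : ⟨ w ⟩ (β + (l * l - k * k) * C)) where

  secant∈ : ⟨ w ⟩ (β - α * (k + l))
  secant∈ = subst ⟨ w ⟩ (identity α β k l C) (Δy∈ ⊕ ((- (k + l)) ⊛ Δx∈))
    where
    identity : ∀ α β k l C →
      (β + (l * l - k * k) * C) + (- (k + l)) * (α + (l - k) * C) ≡ β - α * (k + l)
    identity = solve-∀

  divisor⇒∈ : (α * (k + l) - β) ∣ C → ⟨ w ⟩ α
  divisor⇒∈ (divides Q C≡QN) = subst ⟨ w ⟩ eq (Δx∈ ⊕ ((Q * (l - k)) ⊛ secant∈))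
    where
    open ≡-Reasoning
    identity : ∀ α β k l Q →
      (α + (l - k) * (Q * (α * (k + l) - β))) + Q * (l - k) * (β - α * (k + l)) ≡ α
    identity = solve-∀
    eq : (α + (l - k) * C) + Q * (l - k) * (β - α * (k + l)) ≡ α
    eq = begin
      (α + (l - k) * C) + Q * (l - k) * (β - α * (k + l))
        ≡⟨ cong (λ C → (α + (l - k) * C) + Q * (l - k) * (β - α * (k + l))) C≡QN ⟩
      (α + (l - k) * (Q * (α * (k + l) - β))) + Q * (l - k) * (β - α * (k + l))
        ≡⟨ identity α β k l Q ⟩
      α ∎

⟦_⟧ : Fin 2 → ℤ
⟦ p ⟧ = + toℕ p

δ : Fin 2 → Fin 2 → ℤ
δ p q = ⟦ q ⟧ - ⟦ p ⟧

δ² : ∀ {p q} → p ≢ q → δ p q * δ p q ≡ 1ℤ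
δ² {0F} {0F} p≢q = contradiction refl p≢q
δ² {0F} {1F} _   = refl
δ² {1F} {0F} _   = refl
δ² {1F} {1F} p≢q = contradiction refl p≢q

∣δ∣≡1 : ∀ {p q} → p ≢ q → ∣ δ p q ∣ ≡ 1
∣δ∣≡1 {p} {q} p≢q =
  ℕP.m*n≡1⇒m≡1 ∣ δ p q ∣ ∣ δ p q ∣ (trans (sym (ℤP.abs-* (δ p q) (δ p q))) (cong ∣_∣ (δ² p≢q)))

∣δ∣≤1 : ∀ p q → ∣ δ p q ∣ ≤ 1
∣δ∣≤1 0F 0F = z≤n
∣δ∣≤1 0F 1F = s≤s z≤n
∣δ∣≤1 1F 0F = s≤s z≤n
∣δ∣≤1 1F 1F = z≤n

module MomentCurve (n : ℕ) where

  K : ℕ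
  K = suc (suc (n ℕ.+ n))

  F : ℕ
  F = K !

  2≤F : 2 ≤ F
  2≤F = ℕP.*-mono-≤ (s≤s (s≤s (z≤n {n ℕ.+ n}))) (ℕP.1≤n! (suc (n ℕ.+ n)))

  place : ℕ → Vec (Fin 2) (2 ℕ.+ d) → Point (2 ℕ.+ d)
  place k (a ∷ b ∷ r) = ⟦ a ⟧ + + k * + F ∷ ⟦ b ⟧ + (+ k * + k) * + F ∷ map ⟦_⟧ r

  place-injective : ∀ k l (B B' : Vec (Fin 2) (2 ℕ.+ d)) → place k B ≡ place l B' → k ≡ l
  place-injective k l (a ∷ b ∷ r) (a' ∷ b' ∷ r') eq =
    radix-injective {{K ℕP.!≢0}} (bit<F a) (bit<F a')
      (ℤP.+-injective (trans (sym (as-ℕ a k)) (trans (cong (λ v → lookup v zero) eq) (as-ℕ a' l))))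
    where
    bit<F : ∀ p → toℕ p < F
    bit<F p = ℕP.<-≤-trans (toℕ<n p) 2≤F
    as-ℕ : ∀ p k → ⟦ p ⟧ + + k * + F ≡ + (toℕ p ℕ.+ k ℕ.* F)
    as-ℕ p k = sym (trans (ℤP.pos-+ (toℕ p) _) (cong (λ m → ⟦ p ⟧ + m) (ℤP.pos-* k F)))

  secant-divisor∣F : ∀ {α β k l} → ∣ α ∣ ≡ 1 → ∣ β ∣ ≤ 1 → 1 ≤ k → 1 ≤ l → k ≤ n → l ≤ n →
    (α * (+ k + + l) - β) ∣ + F
  secant-divisor∣F {α} {β} {k} {l} ∣α∣≡1 ∣β∣≤1 1≤k 1≤l k≤n l≤n = nonzero∣! N≢0 ∣N∣≤K
    where
    ∣α[k+l]∣ : ∣ α * (+ k + + l) ∣ ≡ k ℕ.+ l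
    ∣α[k+l]∣ = begin-equality
      ∣ α * (+ k + + l) ∣       ≡⟨ ℤP.abs-* α (+ k + + l) ⟩
      ∣ α ∣ ℕ.* ∣ + k + + l ∣   ≡⟨ cong₂ ℕ._*_ ∣α∣≡1 (cong ∣_∣ (sym (ℤP.pos-+ k l))) ⟩
      1 ℕ.* (k ℕ.+ l)           ≡⟨ ℕP.*-identityˡ (k ℕ.+ l) ⟩
      k ℕ.+ l                   ∎
      where open ℕP.≤-Reasoning
    N≢0 : α * (+ k + + l) - β ≢ 0ℤ
    N≢0 N≡0 = ℕP.<⇒≱ (ℕP.+-mono-≤ 1≤k 1≤l)
      (subst (_≤ 1) (trans (cong ∣_∣ (sym (ℤP.i-j≡0⇒i≡j (α * (+ k + + l)) β N≡0))) ∣α[k+l]∣) ∣β∣≤1)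
    ∣N∣≤K : ∣ α * (+ k + + l) - β ∣ ≤ K
    ∣N∣≤K = begin
      ∣ α * (+ k + + l) - β ∣           ≤⟨ ℤP.∣i-j∣≤∣i∣+∣j∣ (α * (+ k + + l)) β ⟩
      ∣ α * (+ k + + l) ∣ ℕ.+ ∣ β ∣     ≡⟨ cong (ℕ._+ ∣ β ∣) ∣α[k+l]∣ ⟩
      k ℕ.+ l ℕ.+ ∣ β ∣                 ≤⟨ ℕP.+-mono-≤ (ℕP.+-mono-≤ k≤n l≤n) ∣β∣≤1 ⟩
      n ℕ.+ n ℕ.+ 1                     ≡⟨ ℕP.+-comm (n ℕ.+ n) 1 ⟩
      suc (n ℕ.+ n)                     ≤⟨ ℕP.n≤1+n (suc (n ℕ.+ n)) ⟩
      K                                 ∎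
      where open ℕP.≤-Reasoning

  module _ {k l} (1≤k : 1 ≤ k) (1≤l : 1 ≤ l) (k≤n : k ≤ n) (l≤n : l ≤ n) where

    differing-bit∈ : (B B' : Vec (Fin 2) (2 ℕ.+ d)) (i : Fin (2 ℕ.+ d)) →
      lookup B i ≢ lookup B' i → ⟨ Δ (place k B) (place l B') ⟩ (δ (lookup B i) (lookup B' i))
    differing-bit∈ (a ∷ b ∷ r) (a' ∷ b' ∷ r') i ne = by-index i ne
      where
      w = Δ (place k (a ∷ b ∷ r)) (place l (a' ∷ b' ∷ r'))
      shift : ∀ A A' k l C → (A' + l * C) - (A + k * C) ≡ (A' - A) + (l - k) * C
      shift = solve-∀
      Δx∈ : ⟨ w ⟩ (δ a a' + (+ l - + k) * + F)
      Δx∈ = subst ⟨ w ⟩ (shift ⟦ a ⟧ ⟦ a' ⟧ (+ k) (+ l) (+ F)) (gen zero)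
      Δy∈ : ⟨ w ⟩ (δ b b' + (+ l * + l - + k * + k) * + F)
      Δy∈ = subst ⟨ w ⟩ (shift ⟦ b ⟧ ⟦ b' ⟧ (+ k * + k) (+ l * + l) (+ F)) (gen (suc zero))
      open Secant {w = w} {δ a a'} {δ b b'} {+ k} {+ l} {+ F} Δx∈ Δy∈
      Δx-bit∈ : a ≢ a' → ⟨ w ⟩ (δ a a')
      Δx-bit∈ a≢a' = divisor⇒∈
        (secant-divisor∣F {α = δ a a'} {δ b b'} (∣δ∣≡1 a≢a') (∣δ∣≤1 b b') 1≤k 1≤l k≤n l≤n)
      by-index : ∀ i → lookup (a ∷ b ∷ r) i ≢ lookup (a' ∷ b' ∷ r') i →
        ⟨ w ⟩ (δ (lookup (a ∷ b ∷ r) i) (lookup (a' ∷ b' ∷ r') i))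
      by-index zero a≢a' = Δx-bit∈ a≢a'
      by-index (suc zero) _ with a Fin.≟ a'
      ... | yes refl = subst ⟨ w ⟩ δb-0 secant∈
        where
        δb-0 : δ b b' - δ a a * (+ k + + l) ≡ δ b b'
        δb-0 = trans (cong (λ α → δ b b' - α * (+ k + + l)) (ℤP.+-inverseʳ ⟦ a ⟧)) (ℤP.+-identityʳ (δ b b'))
      ... | no a≢a' =
        subst ⟨ w ⟩ (identity (δ b b') (δ a a') (+ k + + l)) (secant∈ ⊕ ((+ k + + l) ⊛ Δx-bit∈ a≢a'))
        where
        identity : ∀ β α s → (β - α * s) + s * α ≡ β
        identity = solve-∀
      by-index (suc (suc j)) _ =
        subst ⟨ w ⟩ (cong₂ _-_ (lookup-map j ⟦_⟧ r') (lookup-map j ⟦_⟧ r)) (gen (suc (suc j)))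

    place-Primitive : (B B' : Vec (Fin 2) (2 ℕ.+ d)) → B ≢ B' → Primitive (place k B) (place l B')
    place-Primitive B B' B≢B' with ¬∀⟶∃¬ _ (λ i → lookup B i ≡ lookup B' i)
                                      (λ i → lookup B i Fin.≟ lookup B' i) (B≢B' ∘ lookup-ext)
    ... | i , ne = unit⇒Primitive (subst ⟨ Δ (place k B) (place l B') ⟩ (δ² ne)
                                          (δ (lookup B i) (lookup B' i) ⊛ differing-bit∈ B B' i ne))

primitive⇒Locatable : ∀ {G : SimpleGraph n} (φ : Fin n → Point d) →
  (∀ u v → φ u ≡ φ v → u ≡ v) → (∀ u v → Edge G u v → Primitive (φ u) (φ v)) → Locatable d G
primitive⇒Locatable φ inj prim =
  φ , (inj , λ u v w e w∈ → Sum.map (inj w u) (inj w v) (prim u v e (φ w) w∈)) , prim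

Edge-irrefl : ∀ (G : SimpleGraph n) {u} → ¬ Edge G u u
Edge-irrefl G {u} e with trans (sym e) (irrefl G u)
... | ()

colorable⇒locatable : ∀ d (G : SimpleGraph n) → Colorable (2 ^ (2 ℕ.+ d)) G → Locatable (2 ℕ.+ d) G
colorable⇒locatable {n} d G (c , proper) = primitive⇒Locatable {G = G} φ φ-injective edge-primitive
  where
  open MomentCurve n
  φ : Fin n → Point (2 ℕ.+ d)
  φ v = place (suc (toℕ v)) (toBits _ (c v))
  φ-injective : ∀ u v → φ u ≡ φ v → u ≡ v
  φ-injective u v eq = toℕ-injective (ℕP.suc-injective (place-injective _ _ _ _ eq))
  edge-primitive : ∀ u v → Edge G u v → Primitive (φ u) (φ v)
  edge-primitive u v e =
    place-Primitive (s≤s z≤n) (s≤s z≤n) (toℕ<n u) (toℕ<n v) _ _ (proper u v e ∘ toBits-injective _)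

locatable⇒colorable : ∀ d (G : SimpleGraph n) → Locatable d G → Colorable (2 ^ d) G
locatable⇒colorable d G (φ , (φ-injective , _) , prim) = color , proper
  where
  color : Fin _ → Fin (2 ^ d)
  color v = fromBits d (map parity (φ v))
  proper : ∀ u v → Edge G u v → color u ≢ color v
  proper u v e same = Edge-irrefl G (subst (Edge G u) (sym u≡v) e)
    where
    parities : map parity (φ u) ≡ map parity (φ v)
    parities = fromBits-injective d same
    u≡v : u ≡ v
    u≡v = φ-injective u v (same-parity-Primitive⇒≡ (prim u v e) λ i → begin
      parity (lookup (φ u) i)       ≡⟨ lookup-map i parity (φ u) ⟨
      lookup (map parity (φ u)) i   ≡⟨ cong (λ p → lookup p i) parities ⟩
      lookup (map parity (φ v)) i   ≡⟨ lookup-map i parity (φ v) ⟩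
      parity (lookup (φ v) i)       ∎)
      where open ≡-Reasoning

mainTheorem3 : (d : ℕ) → 2 ≤ d → (n : ℕ) (G : SimpleGraph n) →
    Colorable (2 ^ d) G ⇔ Locatable d G
mainTheorem3 (suc (suc d)) (s≤s (s≤s z≤n)) n G =
  mk⇔ (colorable⇒locatable d G) (locatable⇒colorable (2 ℕ.+ d) G)
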